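{- Let $b\ge1$, $n\ge1$, and consider a random bucket increasing tree of size $n$ with maximal bucket size $b$ from one of the three growth processes (bucket recursive trees; $(b,d)$-ary increasing trees, $d\ge 2$; $(b,\alpha)$-plane oriented recursive trees, $\alpha>0$). Let $N_{n,j}$ be the number of nodes of capacity $j$ ($1\le j\le b$), and let $K_{n+1}$ be the capacity of the bucket containing label $n+1$ in the tree of size $n+1$ obtained by one further growth step. Then for $2\le m\le b$, \[ \mathbb{P}\{K_{n+1}=m\}=\mathbb{E}(N_{n,m-1})\cdot \begin{cases}\frac{m-1}{n},& \text{bucket recursive trees},\\ \frac{(d-1)(m-1)+1}{(d-1)n+1},&(b,d)\text{ -ary increasing trees},\\ \frac{(\alpha+1)(m-1)-1}{(\alpha+1)n-1},&(b,\alpha)\text{ -plane oriented recursive trees},\end{cases} \] and \[ \mathbb{P}\{K_{n+1}=1\}=\begin{cases}\mathbb{E}(N_{n,b})\frac{b}{n},&\text{bucket recursive trees},\\ \mathbb{E}(N_{n,b})\frac{(d-1)b+1}{(d-1)n+1}+\frac{1-\sum_{j=1}^b\mathbb{E}(N_{n,j})}{(d-1)n+1},&(b,d)\text{ -ary increasing trees},\\ \mathbb{E}(N_{n,b})\frac{(\alpha+1)b-1}{(\alpha+1)n-1}+\frac{ -1+\sum_{j=1}^b\mathbb{E}(N_{n,j})}{(\alpha+1)n-1},&(b,\alpha)\text{ -plane oriented recursive trees}.\end{cases} \]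
   Context: Growth processes with bucket size $b$: start with a root bucket containing label $1$. Given the tree of size $n$ (labels $1,\dots,n$), each node $v$, with capacity $c(v)\in\{1,\dots,b\}$ (number of labels it holds) and out-degree $\deg^+(v)$, is chosen with probability $p(v)$; if $c(v)<b$ (unsaturated), label $n+1$ is added to $v$, otherwise label $n+1$ forms a new child bucket of capacity $1$ of $v$. The probabilities are $p(v)=\frac{c(v)}{n}$ (bucket recursive trees), $p(v)=\frac{(d-1)c(v)+1-\deg^+(v)}{(d-1)n+1}$ ($(b,d)$-ary increasing trees), $p(v)=\frac{\deg^+(v)+(\alpha+1)c(v)-1}{(\alpha+1)n-1}$ ($(b,\alpha)$-plane oriented recursive trees).
   Formalization: The parameter α of the $(b,\alpha)$-plane oriented recursive trees ranges over the positive rationals. -}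

module Defs where

open import Data.Nat as ℕ using (ℕ; zero; suc; _∸_; _<ᵇ_)
open import Data.Integer using (+_)
open import Data.Rational using (ℚ; -_; 0ℚ; 1ℚ; _+_; _*_; _-_; _/_; 1/_; _<_; ≢-nonZero)
open import Data.Rational.Properties using (_≟_)
open import Data.List using (upTo; List; []; _∷_; [_]; _++_; length; map; foldr; concatMap; filter)
open import Data.Product using (_×_; _,_; proj₁; proj₂)
open import Data.Bool using (if_then_else_)
open import Data.Unit using (⊤)
open import Relation.Nullary using (yes; no)
open import Relation.Binary.PropositionalEquality using (_≡_)

⟦_⟧ : ℕ → ℚ
⟦ n ⟧ = (+ n) / 1

-- total division: p ⊘ q = p / q if q ≠ 0, and 0 otherwise
-- (only ever used with a nonzero denominator in the theorem)
_⊘_ : ℚ → ℚ → ℚ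
p ⊘ q with q ≟ 0ℚ
... | yes _  = 0ℚ
... | no q≢0 = p * (1/_ q {{≢-nonZero q≢0}})

sumℚ : List ℚ → ℚ
sumℚ = foldr _+_ 0ℚ

-- Bucket trees: each node (bucket) holds a list of labels
-- (its capacity is the length of that list) and an ordered list of
-- child buckets.

data BTree : Set where
  node : List ℕ → List BTree → BTree

capacity : BTree → ℕ
capacity (node ls _) = length ls

mutual
  caps : BTree → List ℕ
  caps (node ls cs) = length ls ∷ capsL cs

  capsL : List BTree → List ℕ
  capsL []       = []
  capsL (t ∷ ts) = caps t ++ capsL ts

countCap : ℕ → BTree → ℕ
countCap j t = length (filter (λ c → c ℕ.≟ j) (caps t))

-- For each node v of the tree, a Choice records
-- the capacity c(v), the out-degree deg⁺(v) of v (before insertion),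
-- the resulting tree after inserting the new label into/below v, and
-- the capacity of the bucket containing the new label afterwards.

record Choice (A : Set) : Set where
  constructor choice
  field
    cap    : ℕ
    deg    : ℕ
    result : A
    newCap : ℕ

open Choice public

insertRoot : ℕ → ℕ → List ℕ → List BTree → Choice BTree
insertRoot b l ls cs =
  if length ls <ᵇ b
  then choice (length ls) (length cs) (node (ls ++ [ l ]) cs) (suc (length ls))
  else choice (length ls) (length cs) (node ls (cs ++ [ node [ l ] [] ])) 1

mutual
  choices : ℕ → ℕ → BTree → List (Choice BTree)
  choices b l (node ls cs) =
    insertRoot b l ls cs ∷
      map (λ ch → choice (cap ch) (deg ch) (node ls (result ch)) (newCap ch))
          (choicesL b l cs)

  choicesL : ℕ → ℕ → List BTree → List (Choice (List BTree))
  choicesL b l []       = []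
  choicesL b l (t ∷ ts) =
    map (λ ch → choice (cap ch) (deg ch) (result ch ∷ ts) (newCap ch)) (choices b l t)
    ++ map (λ ch → choice (cap ch) (deg ch) (t ∷ result ch) (newCap ch)) (choicesL b l ts)

data Model : Set where
  bucketRecursive : Model
  dAry            : (d : ℕ) → Model
  plane           : (α : ℚ) → Model

ValidModel : Model → Set
ValidModel bucketRecursive = ⊤
ValidModel (dAry d)        = 2 ℕ.≤ d
ValidModel (plane α)       = 0ℚ < α

prob : Model → ℕ → ℕ → ℕ → ℚ
prob bucketRecursive n c deg = ⟦ c ⟧ ⊘ ⟦ n ⟧
prob (dAry d) n c deg =
  (⟦ d ∸ 1 ⟧ * ⟦ c ⟧ + 1ℚ - ⟦ deg ⟧) ⊘ (⟦ d ∸ 1 ⟧ * ⟦ n ⟧ + 1ℚ)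
prob (plane α) n c deg =
  (⟦ deg ⟧ + (α + 1ℚ) * ⟦ c ⟧ - 1ℚ) ⊘ ((α + 1ℚ) * ⟦ n ⟧ - 1ℚ)

-- Distribution of the random tree of size suc k, as a list of
-- (probability, tree) pairs (a finite distribution; trees may repeat).

treeDist′ : ℕ → Model → ℕ → List (ℚ × BTree)
treeDist′ b M zero = [ (1ℚ , node [ 1 ] []) ]
treeDist′ b M (suc k) =
  concatMap (λ wt → map (λ ch → (proj₁ wt * prob M (suc k) (cap ch) (deg ch) , result ch))
                        (choices b (suc (suc k)) (proj₂ wt)))
            (treeDist′ b M k)

treeDist : ℕ → Model → ℕ → List (ℚ × BTree)
treeDist b M n = treeDist′ b M (n ∸ 1)

EN : ℕ → Model → ℕ → ℕ → ℚ
EN b M n j = sumℚ (map (λ wt → proj₁ wt * ⟦ countCap j (proj₂ wt) ⟧) (treeDist b M n))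

PK : ℕ → Model → ℕ → ℕ → ℚ
PK b M n m =
  sumℚ (concatMap
    (λ wt → map (λ ch → proj₁ wt * prob M n (cap ch) (deg ch))
                (filter (λ ch → newCap ch ℕ.≟ m) (choices b (suc n) (proj₂ wt))))
    (treeDist b M n))

sumEN : ℕ → Model → ℕ → ℚ
sumEN b M n = sumℚ (map (λ j → EN b M n (suc j)) (upTo b))

factorMid : Model → ℕ → ℕ → ℚ
factorMid bucketRecursive n m = ⟦ m ∸ 1 ⟧ ⊘ ⟦ n ⟧
factorMid (dAry d) n m =
  (⟦ d ∸ 1 ⟧ * ⟦ m ∸ 1 ⟧ + 1ℚ) ⊘ (⟦ d ∸ 1 ⟧ * ⟦ n ⟧ + 1ℚ)
factorMid (plane α) n m =
  ((α + 1ℚ) * ⟦ m ∸ 1 ⟧ - 1ℚ) ⊘ ((α + 1ℚ) * ⟦ n ⟧ - 1ℚ)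

rhsOne : ℕ → Model → ℕ → ℚ
rhsOne b bucketRecursive n = EN b bucketRecursive n b * (⟦ b ⟧ ⊘ ⟦ n ⟧)
rhsOne b (dAry d) n =
  EN b (dAry d) n b * ((⟦ d ∸ 1 ⟧ * ⟦ b ⟧ + 1ℚ) ⊘ (⟦ d ∸ 1 ⟧ * ⟦ n ⟧ + 1ℚ))
  + (1ℚ - sumEN b (dAry d) n) ⊘ (⟦ d ∸ 1 ⟧ * ⟦ n ⟧ + 1ℚ)
rhsOne b (plane α) n =
  EN b (plane α) n b * (((α + 1ℚ) * ⟦ b ⟧ - 1ℚ) ⊘ ((α + 1ℚ) * ⟦ n ⟧ - 1ℚ))
  + (-_ 1ℚ + sumEN b (plane α) n) ⊘ ((α + 1ℚ) * ⟦ n ⟧ - 1ℚ)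

-- A node of capacity c < b is a leaf, since buckets only get children once full; choosing
-- it puts label n+1 into a bucket of capacity c+1, with probability p(c, 0). Choosing a
-- saturated node puts it into a new bucket of capacity 1. So, given the tree, P{K = m} for
-- 2 ≤ m ≤ b is (number of nodes of capacity m−1)·p(m−1, 0), and P{K = 1} is the sum of
-- p(v) over saturated v. In all three models p(v) is affine in (c(v), deg⁺(v)), and the
-- out-degrees of the saturated nodes add up to all out-degrees, i.e. (number of nodes) − 1.
-- Averaging over the tree of size n gives the formulas; the weights of that tree sum to 1
-- because the p(v) of any tree of size n sum to 1.

module Submission where

open import Defs
open import Data.Nat using (ℕ; _≤_; _∸_)
open import Data.Product using (_×_)
open import Data.Rational using (_*_)
open import Relation.Binary.PropositionalEquality using (_≡_)

import Data.Nat as ℕ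
open import Data.Nat using (suc; _<_; _<ᵇ_; z≤n; s≤s)
import Data.Nat.Properties as ℕₚ
open import Data.Nat.ListAction using (sum)
open import Data.Nat.ListAction.Properties using (sum-++)
open import Data.Nat.Coprimality using (1-coprimeTo) renaming (sym to coprime-sym)
import Data.Integer as ℤ
import Data.Integer.Properties as ℤₚ
open import Data.Rational as ℚ using (ℚ; mkℚ; 0ℚ; 1ℚ; _+_; _-_; -_; Positive; NonNegative)
import Data.Rational.Properties as ℚₚ
open import Data.List using (List; []; _∷_; _++_; [_]; map; length; filter; concatMap; upTo; applyUpTo)
import Data.List.Properties as List
open import Data.List.Relation.Unary.All as All using (All; []; _∷_)
import Data.List.Relation.Unary.All.Properties as All
open import Data.Bool using (true; false; if_then_else_)
open import Data.Product using (_,_; proj₁; proj₂)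
open import Data.Unit using (⊤; tt)
open import Function using (_∘_)
open import Relation.Unary using (Decidable)
open import Relation.Nullary using (Dec; does; yes; no; ¬_; contradiction)
open import Relation.Nullary.Decidable using (dec⇒maybe)
open import Relation.Nullary.Reflects using (ofʸ; ofⁿ)
open import Relation.Binary.PropositionalEquality
  using (refl; sym; trans; cong; cong₂; subst; _≢_; module ≡-Reasoning)
import Tactic.RingSolver.Core.AlmostCommutativeRing as ACR
open import Tactic.RingSolver using (solve-∀)

private
  variable
    A B : Set

ℚ-ring : ACR.AlmostCommutativeRing _ _
ℚ-ring = ACR.fromCommutativeRing ℚₚ.+-*-commutativeRing (λ x → dec⇒maybe (0ℚ ℚₚ.≟ x))

-- In normal form with denominator 1, addition in ℚ reduces to addition in ℤ.
⟦⟧-+ : ∀ a b → ⟦ a ℕ.+ b ⟧ ≡ ⟦ a ⟧ + ⟦ b ⟧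
⟦⟧-+ a b = trans
  (cong (ℚ._/ 1) (sym (cong₂ ℤ._+_ (ℤₚ.*-identityʳ (ℤ.+ a)) (ℤₚ.*-identityʳ (ℤ.+ b)))))
  (sym (cong₂ _+_ (⟦⟧≡mkℚ a) (⟦⟧≡mkℚ b)))
  where
  ⟦⟧≡mkℚ : ∀ n → ⟦ n ⟧ ≡ mkℚ (ℤ.+ n) 0 (coprime-sym (1-coprimeTo n))
  ⟦⟧≡mkℚ n = ℚₚ.normalize-coprime (coprime-sym (1-coprimeTo n))

⊘≡*1⊘ : ∀ p q → p ⊘ q ≡ p * (1ℚ ⊘ q)
⊘≡*1⊘ p q with q ℚₚ.≟ 0ℚ
... | yes _ = sym (ℚₚ.*-zeroʳ p)
... | no _  = cong (p *_) (sym (ℚₚ.*-identityˡ _))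

*-1⊘-inverseʳ : ∀ q → q ≢ 0ℚ → q * (1ℚ ⊘ q) ≡ 1ℚ
*-1⊘-inverseʳ q q≢0 with q ℚₚ.≟ 0ℚ
... | yes q≡0 = contradiction q≡0 q≢0
... | no q≢0  = trans (cong (q *_) (ℚₚ.*-identityˡ _)) (ℚₚ.*-inverseʳ q {{ℚ.≢-nonZero q≢0}})

𝟙[_] : {P : Set} → Dec P → ℚ
𝟙[ p? ] = if does p? then 1ℚ else 0ℚ

𝟙-yes : {P : Set} (p? : Dec P) → P → 𝟙[ p? ] ≡ 1ℚ
𝟙-yes (yes _) _ = refl
𝟙-yes (no ¬p) p = contradiction p ¬p

𝟙-no : {P : Set} (p? : Dec P) → ¬ P → 𝟙[ p? ] ≡ 0ℚ
𝟙-no (yes p) ¬p = contradiction p ¬p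
𝟙-no (no _)  _  = refl

𝟙-*-cong : ∀ {a b : A} (f : A → ℚ) (a≟b : Dec (a ≡ b)) → 𝟙[ a≟b ] * f a ≡ 𝟙[ a≟b ] * f b
𝟙-*-cong f (yes refl) = refl
𝟙-*-cong f (no _)     = trans (ℚₚ.*-zeroˡ (f _)) (sym (ℚₚ.*-zeroˡ (f _)))

sumℚ-++ : ∀ xs ys → sumℚ (xs ++ ys) ≡ sumℚ xs + sumℚ ys
sumℚ-++ []       ys = sym (ℚₚ.+-identityˡ _)
sumℚ-++ (x ∷ xs) ys = trans (cong (x +_) (sumℚ-++ xs ys)) (sym (ℚₚ.+-assoc x _ _))

sumℚ-concatMap : ∀ (f : A → List ℚ) xs → sumℚ (concatMap f xs) ≡ sumℚ (map (sumℚ ∘ f) xs)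
sumℚ-concatMap f []       = refl
sumℚ-concatMap f (x ∷ xs) = trans (sumℚ-++ (f x) (concatMap f xs)) (cong (sumℚ (f x) +_) (sumℚ-concatMap f xs))

sumℚ-*ˡ : ∀ c (f : A → ℚ) xs → sumℚ (map (λ x → c * f x) xs) ≡ c * sumℚ (map f xs)
sumℚ-*ˡ c f []       = sym (ℚₚ.*-zeroʳ c)
sumℚ-*ˡ c f (x ∷ xs) = trans (cong (c * f x +_) (sumℚ-*ˡ c f xs)) (sym (ℚₚ.*-distribˡ-+ c (f x) _))

sumℚ-*ʳ : ∀ c (f : A → ℚ) xs → sumℚ (map (λ x → f x * c) xs) ≡ sumℚ (map f xs) * c
sumℚ-*ʳ c f []       = sym (ℚₚ.*-zeroˡ c)
sumℚ-*ʳ c f (x ∷ xs) = trans (cong (f x * c +_) (sumℚ-*ʳ c f xs)) (sym (ℚₚ.*-distribʳ-+ c (f x) _))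

sumℚ-+ : ∀ (f g : A → ℚ) xs → sumℚ (map (λ x → f x + g x) xs) ≡ sumℚ (map f xs) + sumℚ (map g xs)
sumℚ-+ f g []       = refl
sumℚ-+ f g (x ∷ xs) = trans (cong (f x + g x +_) (sumℚ-+ f g xs)) (interchange (f x) (g x) _ _)
  where
  interchange : ∀ a b c d → (a + b) + (c + d) ≡ (a + c) + (b + d)
  interchange = solve-∀ ℚ-ring

sumℚ-- : ∀ (f g : A → ℚ) xs → sumℚ (map (λ x → f x - g x) xs) ≡ sumℚ (map f xs) - sumℚ (map g xs)
sumℚ-- f g []       = refl
sumℚ-- f g (x ∷ xs) = trans (cong (f x - g x +_) (sumℚ-- f g xs)) (interchange (f x) (g x) _ _)
  where
  interchange : ∀ a b c d → (a - b) + (c - d) ≡ (a + c) - (b + d)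
  interchange = solve-∀ ℚ-ring

sumℚ-zeros : ∀ (xs : List A) → sumℚ (map (λ _ → 0ℚ) xs) ≡ 0ℚ
sumℚ-zeros []       = refl
sumℚ-zeros (_ ∷ xs) = trans (ℚₚ.+-identityˡ _) (sumℚ-zeros xs)

sumℚ-swap : ∀ (f : A → B → ℚ) is xs →
  sumℚ (map (λ i → sumℚ (map (f i) xs)) is) ≡ sumℚ (map (λ x → sumℚ (map (λ i → f i x) is)) xs)
sumℚ-swap f []       xs = sym (sumℚ-zeros xs)
sumℚ-swap f (i ∷ is) xs =
  trans (cong (sumℚ (map (f i) xs) +_) (sumℚ-swap f is xs))
        (sym (sumℚ-+ (f i) (λ x → sumℚ (map (λ i → f i x) is)) xs))

sumℚ-filter : ∀ {P : A → Set} (P? : Decidable P) (f : A → ℚ) xs →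
  sumℚ (map f (filter P? xs)) ≡ sumℚ (map (λ x → 𝟙[ P? x ] * f x) xs)
sumℚ-filter P? f []       = refl
sumℚ-filter P? f (x ∷ xs) with P? x
... | yes _ = cong₂ _+_ (sym (ℚₚ.*-identityˡ (f x))) (sumℚ-filter P? f xs)
... | no _  = trans (sumℚ-filter P? f xs)
                    (sym (trans (cong (_+ _) (ℚₚ.*-zeroˡ (f x))) (ℚₚ.+-identityˡ _)))

⟦sum⟧ : ∀ (f : A → ℕ) xs → ⟦ sum (map f xs) ⟧ ≡ sumℚ (map (⟦_⟧ ∘ f) xs)
⟦sum⟧ f []       = refl
⟦sum⟧ f (x ∷ xs) = trans (⟦⟧-+ (f x) _) (cong (⟦ f x ⟧ +_) (⟦sum⟧ f xs))

⟦length⟧ : ∀ (xs : List A) → ⟦ length xs ⟧ ≡ sumℚ (map (λ _ → 1ℚ) xs)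
⟦length⟧ []       = refl
⟦length⟧ (x ∷ xs) = trans (⟦⟧-+ 1 (length xs)) (cong (1ℚ +_) (⟦length⟧ xs))

⟦length-filter⟧ : ∀ {P : A → Set} (P? : Decidable P) xs →
  ⟦ length (filter P? xs) ⟧ ≡ sumℚ (map (λ x → 𝟙[ P? x ]) xs)
⟦length-filter⟧ P? []       = refl
⟦length-filter⟧ P? (x ∷ xs) with P? x
... | yes _ = trans (⟦⟧-+ 1 (length (filter P? xs))) (cong (1ℚ +_) (⟦length-filter⟧ P? xs))
... | no _  = trans (⟦length-filter⟧ P? xs) (sym (ℚₚ.+-identityˡ _))

-- Each c ∈ [1, b] is counted by exactly one j < b, namely j = c - 1.
sum-count-upTo : ∀ b cs → All (λ c → 1 ≤ c × c ≤ b) cs →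
  sumℚ (map (λ j → ⟦ length (filter (ℕ._≟ suc j) cs) ⟧) (upTo b)) ≡ ⟦ length cs ⟧
sum-count-upTo b cs range = begin
  sumℚ (map (λ j → ⟦ length (filter (ℕ._≟ suc j) cs) ⟧) (upTo b))
    ≡⟨ cong sumℚ (List.map-cong (λ j → ⟦length-filter⟧ (ℕ._≟ suc j) cs) (upTo b)) ⟩
  sumℚ (map (λ j → sumℚ (map (λ c → 𝟙[ c ℕ.≟ suc j ]) cs)) (upTo b))
    ≡⟨ sumℚ-swap (λ j c → 𝟙[ c ℕ.≟ suc j ]) (upTo b) cs ⟩
  sumℚ (map (λ c → sumℚ (map (λ j → 𝟙[ c ℕ.≟ suc j ]) (upTo b))) cs)
    ≡⟨ cong sumℚ (List.map-cong-local (All.map counted-once range)) ⟩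
  sumℚ (map (λ _ → 1ℚ) cs)
    ≡⟨ sym (⟦length⟧ cs) ⟩
  ⟦ length cs ⟧ ∎
  where
  open ≡-Reasoning
  once : ∀ b c → c < b → sumℚ (applyUpTo (λ j → 𝟙[ c ℕ.≟ j ]) b) ≡ 1ℚ
  once (suc b) ℕ.zero    _         =
    trans (cong (1ℚ +_) (trans (cong sumℚ (sym (List.map-upTo (λ _ → 0ℚ) b))) (sumℚ-zeros (upTo b))))
          (ℚₚ.+-identityʳ 1ℚ)
  once (suc b) (suc c)   (s≤s c<b) = trans (ℚₚ.+-identityˡ _) (once b c c<b)
  counted-once : ∀ {c} → 1 ≤ c × c ≤ b → sumℚ (map (λ j → 𝟙[ c ℕ.≟ suc j ]) (upTo b)) ≡ 1ℚ
  counted-once {suc c} (_ , c<b) = trans (cong sumℚ (List.map-upTo _ b)) (once b c c<b)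

-- In all three models p(v) is proportional to capCoeff · c(v) + offsetCoeff · (1 − deg⁺(v)).
capCoeff offsetCoeff : Model → ℚ
capCoeff bucketRecursive = 1ℚ
capCoeff (dAry d)        = ⟦ d ∸ 1 ⟧
capCoeff (plane α)       = α + 1ℚ
offsetCoeff bucketRecursive = 0ℚ
offsetCoeff (dAry d)        = 1ℚ
offsetCoeff (plane α)       = - 1ℚ

weight : Model → ℕ → ℕ → ℚ
weight M c g = capCoeff M * ⟦ c ⟧ + offsetCoeff M * (1ℚ - ⟦ g ⟧)

denominator : Model → ℕ → ℚ
denominator bucketRecursive n = ⟦ n ⟧
denominator (dAry d)        n = ⟦ d ∸ 1 ⟧ * ⟦ n ⟧ + 1ℚ
denominator (plane α)       n = (α + 1ℚ) * ⟦ n ⟧ - 1ℚ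

denominator≡ : ∀ M n → denominator M n ≡ capCoeff M * ⟦ n ⟧ + offsetCoeff M
denominator≡ bucketRecursive n = sym (trans (ℚₚ.+-identityʳ _) (ℚₚ.*-identityˡ _))
denominator≡ (dAry d)        n = refl
denominator≡ (plane α)       n = refl

denominator≢0 : ∀ M → ValidModel M → ∀ n → denominator M (suc n) ≢ 0ℚ
denominator≢0 M valid n eq = ℚₚ.<⇒≢ (ℚₚ.positive⁻¹ _ {{positive M valid}}) (sym eq)
  where
  ⟦⟧-nonNeg : ∀ k → NonNegative ⟦ k ⟧
  ⟦⟧-nonNeg k = ℚₚ.normalize-nonNeg k 1
  ⟦suc⟧-pos : Positive ⟦ suc n ⟧
  ⟦suc⟧-pos = ℚₚ.normalize-pos (suc n) 1
  positive : ∀ M → ValidModel M → Positive (denominator M (suc n))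
  positive bucketRecursive _ = ⟦suc⟧-pos
  positive (dAry d) _ =
    ℚₚ.nonNeg+pos⇒pos (⟦ d ∸ 1 ⟧ * ⟦ suc n ⟧)
      {{ℚₚ.nonNeg*nonNeg⇒nonNeg ⟦ d ∸ 1 ⟧ {{⟦⟧-nonNeg (d ∸ 1)}} ⟦ suc n ⟧ {{⟦⟧-nonNeg (suc n)}}}} 1ℚ
  positive (plane α) α>0 =
    subst Positive (sym split) (ℚₚ.pos+nonNeg⇒pos (α * ⟦ suc n ⟧) {{α*⟦suc⟧-pos}} ⟦ n ⟧ {{⟦⟧-nonNeg n}})
    where
    α*⟦suc⟧-pos : Positive (α * ⟦ suc n ⟧)
    α*⟦suc⟧-pos = ℚₚ.pos*pos⇒pos α {{ℚ.positive α>0}} ⟦ suc n ⟧ {{⟦suc⟧-pos}}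
    ring : ∀ a x → (a + 1ℚ) * (1ℚ + x) - 1ℚ ≡ a * (1ℚ + x) + x
    ring = solve-∀ ℚ-ring
    split : (α + 1ℚ) * ⟦ suc n ⟧ - 1ℚ ≡ α * ⟦ suc n ⟧ + ⟦ n ⟧
    split = begin
      (α + 1ℚ) * ⟦ suc n ⟧ - 1ℚ    ≡⟨ cong (λ z → (α + 1ℚ) * z - 1ℚ) (⟦⟧-+ 1 n) ⟩
      (α + 1ℚ) * (1ℚ + ⟦ n ⟧) - 1ℚ ≡⟨ ring α ⟦ n ⟧ ⟩
      α * (1ℚ + ⟦ n ⟧) + ⟦ n ⟧     ≡⟨ cong (λ z → α * z + ⟦ n ⟧) (sym (⟦⟧-+ 1 n)) ⟩
      α * ⟦ suc n ⟧ + ⟦ n ⟧        ∎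
      where open ≡-Reasoning

prob≡weight : ∀ M n c g → prob M n c g ≡ weight M c g * (1ℚ ⊘ denominator M n)
prob≡weight bucketRecursive n c g =
  trans (⊘≡*1⊘ _ ⟦ n ⟧) (cong (_* (1ℚ ⊘ ⟦ n ⟧)) (ring ⟦ c ⟧ ⟦ g ⟧))
  where
  ring : ∀ x y → x ≡ 1ℚ * x + 0ℚ * (1ℚ - y)
  ring = solve-∀ ℚ-ring
prob≡weight (dAry d) n c g =
  trans (⊘≡*1⊘ _ (denominator (dAry d) n)) (cong (_* _) (ring ⟦ d ∸ 1 ⟧ ⟦ c ⟧ ⟦ g ⟧))
  where
  ring : ∀ a x y → a * x + 1ℚ - y ≡ a * x + 1ℚ * (1ℚ - y)
  ring = solve-∀ ℚ-ring
prob≡weight (plane α) n c g =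
  trans (⊘≡*1⊘ _ (denominator (plane α) n)) (cong (_* _) (ring α ⟦ c ⟧ ⟦ g ⟧))
  where
  ring : ∀ a x y → y + (a + 1ℚ) * x - 1ℚ ≡ (a + 1ℚ) * x + - 1ℚ * (1ℚ - y)
  ring = solve-∀ ℚ-ring

factorMid≡prob : ∀ M n m → factorMid M n m ≡ prob M n (m ∸ 1) 0
factorMid≡prob bucketRecursive n m = refl
factorMid≡prob (dAry d) n m = cong (_⊘ denominator (dAry d) n) (ring ⟦ d ∸ 1 ⟧ ⟦ m ∸ 1 ⟧)
  where
  ring : ∀ a x → a * x + 1ℚ ≡ a * x + 1ℚ - 0ℚ
  ring = solve-∀ ℚ-ring
factorMid≡prob (plane α) n m = cong (_⊘ denominator (plane α) n) (ring α ⟦ m ∸ 1 ⟧)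
  where
  ring : ∀ a x → (a + 1ℚ) * x - 1ℚ ≡ 0ℚ + (a + 1ℚ) * x - 1ℚ
  ring = solve-∀ ℚ-ring

rhsOne≡ : ∀ b M n → rhsOne b M n ≡
  (EN b M n b * weight M b 0 + offsetCoeff M * (1ℚ - sumEN b M n)) * (1ℚ ⊘ denominator M n)
rhsOne≡ b bucketRecursive n =
  trans (cong (E *_) (⊘≡*1⊘ ⟦ b ⟧ ⟦ n ⟧)) (ring E ⟦ b ⟧ (sumEN b bucketRecursive n) (1ℚ ⊘ ⟦ n ⟧))
  where
  E = EN b bucketRecursive n b
  ring : ∀ e x s i → e * (x * i) ≡ (e * (1ℚ * x + 0ℚ * (1ℚ - 0ℚ)) + 0ℚ * (1ℚ - s)) * i
  ring = solve-∀ ℚ-ring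
rhsOne≡ b (dAry d) n =
  trans (cong₂ _+_ (cong (E *_) (⊘≡*1⊘ _ D)) (⊘≡*1⊘ _ D))
        (ring E ⟦ d ∸ 1 ⟧ ⟦ b ⟧ (sumEN b (dAry d) n) (1ℚ ⊘ D))
  where
  E = EN b (dAry d) n b
  D = denominator (dAry d) n
  ring : ∀ e a x s i →
    e * ((a * x + 1ℚ) * i) + (1ℚ - s) * i ≡ (e * (a * x + 1ℚ * (1ℚ - 0ℚ)) + 1ℚ * (1ℚ - s)) * i
  ring = solve-∀ ℚ-ring
rhsOne≡ b (plane α) n =
  trans (cong₂ _+_ (cong (E *_) (⊘≡*1⊘ _ D)) (⊘≡*1⊘ _ D))
        (ring E α ⟦ b ⟧ (sumEN b (plane α) n) (1ℚ ⊘ D))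
  where
  E = EN b (plane α) n b
  D = denominator (plane α) n
  ring : ∀ e a x s i →
    e * (((a + 1ℚ) * x - 1ℚ) * i) + (- 1ℚ + s) * i
      ≡ (e * ((a + 1ℚ) * x + - 1ℚ * (1ℚ - 0ℚ)) + - 1ℚ * (1ℚ - s)) * i
  ring = solve-∀ ℚ-ring

mutual
  WellFormed : ℕ → BTree → Set
  WellFormed b (node ls cs) =
    1 ≤ length ls × length ls ≤ b × (length ls < b → cs ≡ []) × AllWellFormed b cs

  AllWellFormed : ℕ → List BTree → Set
  AllWellFormed b []       = ⊤
  AllWellFormed b (t ∷ ts) = WellFormed b t × AllWellFormed b ts

AllWellFormed-++ : ∀ {b} ts us → AllWellFormed b ts → AllWellFormed b us → AllWellFormed b (ts ++ us)
AllWellFormed-++ []       us _          wfu = wfu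
AllWellFormed-++ (t ∷ ts) us (wf , wfs) wfu = wf , AllWellFormed-++ ts us wfs wfu

mutual
  caps-range : ∀ {b} t → WellFormed b t → All (λ c → 1 ≤ c × c ≤ b) (caps t)
  caps-range (node ls cs) (1≤c , c≤b , _ , wfs) = (1≤c , c≤b) ∷ capsL-range cs wfs

  capsL-range : ∀ {b} ts → AllWellFormed b ts → All (λ c → 1 ≤ c × c ≤ b) (capsL ts)
  capsL-range []       _          = []
  capsL-range (t ∷ ts) (wf , wfs) = All.++⁺ (caps-range t wf) (capsL-range ts wfs)

capsL-++ : ∀ ts us → capsL (ts ++ us) ≡ capsL ts ++ capsL us
capsL-++ []       us = refl
capsL-++ (t ∷ ts) us = trans (cong (caps t ++_) (capsL-++ ts us)) (sym (List.++-assoc (caps t) _ _))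

size : BTree → ℕ
size t = sum (caps t)

-- An unsaturated node (c < b) is a leaf and absorbs the label; a saturated one spawns a
-- child bucket of capacity 1. The indices are capacity, out-degree and the capacity of
-- the bucket that receives the label.
data Insertion (b : ℕ) : ℕ → ℕ → ℕ → Set where
  fill  : ∀ {c} → 1 ≤ c → c < b → Insertion b c 0 (suc c)
  spawn : ∀ {d} → Insertion b b d 1

ValidChoice : ℕ → Choice A → Set
ValidChoice b ch = Insertion b (cap ch) (deg ch) (newCap ch)

insertRoot-cap : ∀ b l ls cs → cap (insertRoot b l ls cs) ≡ length ls
insertRoot-cap b l ls cs with length ls <ᵇ b
... | true  = refl
... | false = refl

insertRoot-deg : ∀ b l ls cs → deg (insertRoot b l ls cs) ≡ length cs
insertRoot-deg b l ls cs with length ls <ᵇ b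
... | true  = refl
... | false = refl

insertRoot-valid : ∀ b l ls cs → WellFormed b (node ls cs) → ValidChoice b (insertRoot b l ls cs)
insertRoot-valid b l ls cs (1≤c , c≤b , leaf , _)
  with length ls <ᵇ b | ℕₚ.<ᵇ-reflects-< (length ls) b
... | true  | ofʸ c<b with leaf c<b
...   | refl = fill 1≤c c<b
insertRoot-valid b l ls cs (1≤c , c≤b , leaf , _)
    | false | ofⁿ c≮b =
  subst (λ c → Insertion b c (length cs) 1) (sym (ℕₚ.≤-antisym c≤b (ℕₚ.≮⇒≥ c≮b))) spawn

underRoot : List ℕ → Choice (List BTree) → Choice BTree
underRoot ls ch = choice (cap ch) (deg ch) (node ls (result ch)) (newCap ch)

inHead : List BTree → Choice BTree → Choice (List BTree)
inHead ts ch = choice (cap ch) (deg ch) (result ch ∷ ts) (newCap ch)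

inTail : BTree → Choice (List BTree) → Choice (List BTree)
inTail t ch = choice (cap ch) (deg ch) (t ∷ result ch) (newCap ch)

Grows : ℕ → BTree → Choice BTree → Set
Grows b t ch = WellFormed b (result ch) × size (result ch) ≡ suc (size t)

GrowsL : ℕ → List BTree → Choice (List BTree) → Set
GrowsL b ts ch = AllWellFormed b (result ch) × sum (capsL (result ch)) ≡ suc (sum (capsL ts))

insertRoot-grows : ∀ b l ls cs → 1 ≤ b → WellFormed b (node ls cs) → Grows b (node ls cs) (insertRoot b l ls cs)
insertRoot-grows b l ls cs 1≤b (1≤c , c≤b , leaf , wfs)
  with length ls <ᵇ b | ℕₚ.<ᵇ-reflects-< (length ls) b
... | true  | ofʸ c<b with leaf c<b
...   | refl =
  (subst (1 ≤_) (sym length-∷ʳ) (s≤s z≤n) , subst (_≤ b) (sym length-∷ʳ) c<b , (λ _ → refl) , tt) ,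
  cong (ℕ._+ 0) length-∷ʳ
  where
  length-∷ʳ : length (ls ++ [ l ]) ≡ suc (length ls)
  length-∷ʳ = trans (List.length-++ ls) (ℕₚ.+-comm (length ls) 1)
insertRoot-grows b l ls cs 1≤b (1≤c , c≤b , leaf , wfs)
    | false | ofⁿ c≮b =
  (1≤c , c≤b , (λ c<b → contradiction c<b c≮b) , AllWellFormed-++ cs _ wfs (newLeaf , tt)) , grows
  where
  newLeaf : WellFormed b (node [ l ] [])
  newLeaf = s≤s z≤n , 1≤b , (λ _ → refl) , tt
  grows : length ls ℕ.+ sum (capsL (cs ++ [ node [ l ] [] ])) ≡ suc (length ls ℕ.+ sum (capsL cs))
  grows = begin
    length ls ℕ.+ sum (capsL (cs ++ [ node [ l ] [] ]))
      ≡⟨ cong (λ xs → length ls ℕ.+ sum xs) (capsL-++ cs _) ⟩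
    length ls ℕ.+ sum (capsL cs ++ [ 1 ])
      ≡⟨ cong (length ls ℕ.+_) (trans (sum-++ (capsL cs) [ 1 ]) (ℕₚ.+-comm (sum (capsL cs)) 1)) ⟩
    length ls ℕ.+ suc (sum (capsL cs))
      ≡⟨ ℕₚ.+-suc (length ls) _ ⟩
    suc (length ls ℕ.+ sum (capsL cs)) ∎
    where open ≡-Reasoning

mutual
  choices-valid : ∀ b l t → WellFormed b t → All (ValidChoice b) (choices b l t)
  choices-valid b l (node ls cs) wf@(_ , _ , _ , wfs) =
    insertRoot-valid b l ls cs wf ∷ All.map⁺ (choicesL-valid b l cs wfs)

  choicesL-valid : ∀ b l ts → AllWellFormed b ts → All (ValidChoice b) (choicesL b l ts)
  choicesL-valid b l []       _          = []
  choicesL-valid b l (t ∷ ts) (wf , wfs) =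
    All.++⁺ (All.map⁺ (choices-valid b l t wf)) (All.map⁺ (choicesL-valid b l ts wfs))

mutual
  choices-grow : ∀ b l t → 1 ≤ b → WellFormed b t → All (Grows b t) (choices b l t)
  choices-grow b l (node ls []) 1≤b wf = insertRoot-grows b l ls [] 1≤b wf ∷ []
  choices-grow b l (node ls cs@(_ ∷ _)) 1≤b wf@(1≤c , c≤b , leaf , wfs) =
    insertRoot-grows b l ls cs 1≤b wf ∷
      All.map⁺ {f = underRoot ls} (All.map (λ {ch} → child {ch}) (choicesL-grow b l cs 1≤b wfs))
    where
    child : ∀ {ch} → GrowsL b cs ch → Grows b (node ls cs) (underRoot ls ch)
    child (wfs′ , grows) =
      (1≤c , c≤b , (λ c<b → contradiction (leaf c<b) λ ()) , wfs′) ,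
      trans (cong (length ls ℕ.+_) grows) (ℕₚ.+-suc (length ls) _)

  choicesL-grow : ∀ b l ts → 1 ≤ b → AllWellFormed b ts → All (GrowsL b ts) (choicesL b l ts)
  choicesL-grow b l []       _   _          = []
  choicesL-grow b l (t ∷ ts) 1≤b (wf , wfs) =
    All.++⁺ (All.map⁺ {f = inHead ts} (All.map (λ {ch} → head {ch}) (choices-grow b l t 1≤b wf)))
            (All.map⁺ {f = inTail t} (All.map (λ {ch} → tail {ch}) (choicesL-grow b l ts 1≤b wfs)))
    where
    head : ∀ {ch} → Grows b t ch → GrowsL b (t ∷ ts) (inHead ts ch)
    head {ch} (wf′ , grows) = (wf′ , wfs) ,
      trans (sum-++ (caps (result ch)) (capsL ts))
            (trans (cong (ℕ._+ sum (capsL ts)) grows) (cong suc (sym (sum-++ (caps t) (capsL ts)))))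
    tail : ∀ {ch} → GrowsL b ts ch → GrowsL b (t ∷ ts) (inTail t ch)
    tail {ch} (wfs′ , grows) = (wf , wfs′) ,
      trans (sum-++ (caps t) (capsL (result ch)))
            (trans (cong (sum (caps t) ℕ.+_) grows)
                   (trans (ℕₚ.+-suc (sum (caps t)) _) (cong suc (sym (sum-++ (caps t) (capsL ts))))))

mutual
  map-cap-choices : ∀ b l t → map cap (choices b l t) ≡ caps t
  map-cap-choices b l (node ls cs) =
    cong₂ _∷_ (insertRoot-cap b l ls cs) (trans (sym (List.map-∘ (choicesL b l cs))) (map-cap-choicesL b l cs))

  map-cap-choicesL : ∀ b l ts → map cap (choicesL b l ts) ≡ capsL ts
  map-cap-choicesL b l []       = refl
  map-cap-choicesL b l (t ∷ ts) =
    trans (List.map-++ cap (map (inHead ts) (choices b l t)) _)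
          (cong₂ _++_ (trans (sym (List.map-∘ (choices b l t))) (map-cap-choices b l t))
                      (trans (sym (List.map-∘ (choicesL b l ts))) (map-cap-choicesL b l ts)))

-- Every node but the root is the child of exactly one node.
mutual
  sum-deg-choices : ∀ b l t → suc (sum (map deg (choices b l t))) ≡ length (caps t)
  sum-deg-choices b l (node ls cs) = cong suc (begin
    deg (insertRoot b l ls cs) ℕ.+ sum (map deg (map (underRoot ls) (choicesL b l cs)))
      ≡⟨ cong₂ ℕ._+_ (insertRoot-deg b l ls cs) (cong sum (sym (List.map-∘ (choicesL b l cs)))) ⟩
    length cs ℕ.+ sum (map deg (choicesL b l cs))
      ≡⟨ ℕₚ.+-comm (length cs) _ ⟩
    sum (map deg (choicesL b l cs)) ℕ.+ length cs
      ≡⟨ sum-deg-choicesL b l cs ⟩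
    length (capsL cs) ∎)
    where open ≡-Reasoning

  sum-deg-choicesL : ∀ b l ts → sum (map deg (choicesL b l ts)) ℕ.+ length ts ≡ length (capsL ts)
  sum-deg-choicesL b l []       = refl
  sum-deg-choicesL b l (t ∷ ts) = begin
    sum (map deg (map (inHead ts) (choices b l t) ++ map (inTail t) (choicesL b l ts))) ℕ.+ suc (length ts)
      ≡⟨ cong (ℕ._+ suc (length ts)) split ⟩
    (x ℕ.+ y) ℕ.+ suc (length ts)
      ≡⟨ rearrange x y (length ts) ⟩
    suc x ℕ.+ (y ℕ.+ length ts)
      ≡⟨ cong₂ ℕ._+_ (sum-deg-choices b l t) (sum-deg-choicesL b l ts) ⟩
    length (caps t) ℕ.+ length (capsL ts)
      ≡⟨ sym (List.length-++ (caps t)) ⟩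
    length (caps t ++ capsL ts) ∎
    where
    open ≡-Reasoning
    x = sum (map deg (choices b l t))
    y = sum (map deg (choicesL b l ts))
    split : sum (map deg (map (inHead ts) (choices b l t) ++ map (inTail t) (choicesL b l ts))) ≡ x ℕ.+ y
    split = trans (cong sum (List.map-++ deg (map (inHead ts) (choices b l t)) _))
      (trans (sum-++ (map deg (map (inHead ts) (choices b l t))) _)
             (cong₂ ℕ._+_ (cong sum (sym (List.map-∘ (choices b l t))))
                          (cong sum (sym (List.map-∘ (choicesL b l ts))))))
    rearrange : ∀ x y z → (x ℕ.+ y) ℕ.+ suc z ≡ suc x ℕ.+ (y ℕ.+ z)
    rearrange x y z = trans (ℕₚ.+-suc (x ℕ.+ y) z) (cong suc (ℕₚ.+-assoc x y z))

⟦countCap⟧ : ∀ b l t j → ⟦ countCap j t ⟧ ≡ sumℚ (map (λ ch → 𝟙[ cap ch ℕ.≟ j ]) (choices b l t))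
⟦countCap⟧ b l t j = begin
  ⟦ length (filter (ℕ._≟ j) (caps t)) ⟧
    ≡⟨ cong (λ cs → ⟦ length (filter (ℕ._≟ j) cs) ⟧) (sym (map-cap-choices b l t)) ⟩
  ⟦ length (filter (ℕ._≟ j) (map cap (choices b l t))) ⟧
    ≡⟨ ⟦length-filter⟧ (ℕ._≟ j) (map cap (choices b l t)) ⟩
  sumℚ (map (λ c → 𝟙[ c ℕ.≟ j ]) (map cap (choices b l t)))
    ≡⟨ cong sumℚ (sym (List.map-∘ (choices b l t))) ⟩
  sumℚ (map (λ ch → 𝟙[ cap ch ℕ.≟ j ]) (choices b l t)) ∎
  where open ≡-Reasoning

⟦nodes⟧ : ∀ b l t → ⟦ length (caps t) ⟧ ≡ 1ℚ + ⟦ sum (map deg (choices b l t)) ⟧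
⟦nodes⟧ b l t = trans (cong ⟦_⟧ (sym (sum-deg-choices b l t))) (⟦⟧-+ 1 (sum (map deg (choices b l t))))

insertion-mid : ∀ {b c d k m} (p : ℕ → ℕ → ℚ) → Insertion b c d k → 2 ≤ m → m ≤ b →
  𝟙[ k ℕ.≟ m ] * p c d ≡ 𝟙[ c ℕ.≟ m ∸ 1 ] * p (m ∸ 1) 0
insertion-mid {c = c} {m = suc m} p (fill _ _) (s≤s (s≤s _)) _ = 𝟙-*-cong (λ x → p x 0) (c ℕ.≟ m)
insertion-mid {b} {d = d} {m = suc m} p spawn (s≤s (s≤s _)) m<b =
  trans (ℚₚ.*-zeroˡ (p b d))
        (sym (trans (cong (_* p m 0) (𝟙-no (b ℕ.≟ m) (ℕₚ.>⇒≢ m<b))) (ℚₚ.*-zeroˡ (p m 0))))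

insertion-one : ∀ {b c d k} M → Insertion b c d k →
  𝟙[ k ℕ.≟ 1 ] * weight M c d ≡ 𝟙[ c ℕ.≟ b ] * weight M b 0 - offsetCoeff M * ⟦ d ⟧
insertion-one {b} {c} M (fill (s≤s _) c<b) =
  trans (ring (weight M c 0) (weight M b 0) (offsetCoeff M))
        (cong (λ z → z * weight M b 0 - offsetCoeff M * 0ℚ) (sym (𝟙-no (c ℕ.≟ b) (ℕₚ.<⇒≢ c<b))))
  where
  ring : ∀ x y z → 0ℚ * x ≡ 0ℚ * y - z * 0ℚ
  ring = solve-∀ ℚ-ring
insertion-one {b} M (spawn {d}) =
  trans (ring (capCoeff M) (offsetCoeff M) ⟦ b ⟧ ⟦ d ⟧)
        (cong (λ z → z * weight M b 0 - offsetCoeff M * ⟦ d ⟧) (sym (𝟙-yes (b ℕ.≟ b) refl)))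
  where
  ring : ∀ a o x y → 1ℚ * (a * x + o * (1ℚ - y)) ≡ 1ℚ * (a * x + o * (1ℚ - 0ℚ)) - o * y
  ring = solve-∀ ℚ-ring

sum-newCap-mid : ∀ {b m} (p : ℕ → ℕ → ℚ) (xs : List (Choice A)) → All (ValidChoice b) xs →
  2 ≤ m → m ≤ b →
  sumℚ (map (λ ch → p (cap ch) (deg ch)) (filter (λ ch → newCap ch ℕ.≟ m) xs))
    ≡ sumℚ (map (λ ch → 𝟙[ cap ch ℕ.≟ m ∸ 1 ]) xs) * p (m ∸ 1) 0
sum-newCap-mid {m = m} p xs valid 2≤m m≤b = begin
  sumℚ (map (λ ch → p (cap ch) (deg ch)) (filter (λ ch → newCap ch ℕ.≟ m) xs))
    ≡⟨ sumℚ-filter (λ ch → newCap ch ℕ.≟ m) (λ ch → p (cap ch) (deg ch)) xs ⟩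
  sumℚ (map (λ ch → 𝟙[ newCap ch ℕ.≟ m ] * p (cap ch) (deg ch)) xs)
    ≡⟨ cong sumℚ (List.map-cong-local (All.map (λ v → insertion-mid p v 2≤m m≤b) valid)) ⟩
  sumℚ (map (λ ch → 𝟙[ cap ch ℕ.≟ m ∸ 1 ] * p (m ∸ 1) 0) xs)
    ≡⟨ sumℚ-*ʳ (p (m ∸ 1) 0) (λ ch → 𝟙[ cap ch ℕ.≟ m ∸ 1 ]) xs ⟩
  sumℚ (map (λ ch → 𝟙[ cap ch ℕ.≟ m ∸ 1 ]) xs) * p (m ∸ 1) 0 ∎
  where open ≡-Reasoning

sum-newCap-one : ∀ {b} M (xs : List (Choice A)) → All (ValidChoice b) xs →
  sumℚ (map (λ ch → weight M (cap ch) (deg ch)) (filter (λ ch → newCap ch ℕ.≟ 1) xs))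
    ≡ sumℚ (map (λ ch → 𝟙[ cap ch ℕ.≟ b ]) xs) * weight M b 0 - offsetCoeff M * ⟦ sum (map deg xs) ⟧
sum-newCap-one {b = b} M xs valid = begin
  sumℚ (map (λ ch → weight M (cap ch) (deg ch)) (filter (λ ch → newCap ch ℕ.≟ 1) xs))
    ≡⟨ sumℚ-filter (λ ch → newCap ch ℕ.≟ 1) (λ ch → weight M (cap ch) (deg ch)) xs ⟩
  sumℚ (map (λ ch → 𝟙[ newCap ch ℕ.≟ 1 ] * weight M (cap ch) (deg ch)) xs)
    ≡⟨ cong sumℚ (List.map-cong-local (All.map (insertion-one M) valid)) ⟩
  sumℚ (map (λ ch → 𝟙[ cap ch ℕ.≟ b ] * weight M b 0 - offsetCoeff M * ⟦ deg ch ⟧) xs)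
    ≡⟨ sumℚ-- (λ ch → 𝟙[ cap ch ℕ.≟ b ] * weight M b 0) (λ ch → offsetCoeff M * ⟦ deg ch ⟧) xs ⟩
  sumℚ (map (λ ch → 𝟙[ cap ch ℕ.≟ b ] * weight M b 0) xs)
    - sumℚ (map (λ ch → offsetCoeff M * ⟦ deg ch ⟧) xs)
    ≡⟨ cong₂ _-_ (sumℚ-*ʳ (weight M b 0) (λ ch → 𝟙[ cap ch ℕ.≟ b ]) xs)
                 (trans (sumℚ-*ˡ (offsetCoeff M) (⟦_⟧ ∘ deg) xs)
                        (cong (offsetCoeff M *_) (sym (⟦sum⟧ deg xs)))) ⟩
  sumℚ (map (λ ch → 𝟙[ cap ch ℕ.≟ b ]) xs) * weight M b 0 - offsetCoeff M * ⟦ sum (map deg xs) ⟧ ∎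
  where open ≡-Reasoning

sum-weight : ∀ M (xs : List (Choice A)) → sumℚ (map (λ ch → weight M (cap ch) (deg ch)) xs)
  ≡ capCoeff M * ⟦ sum (map cap xs) ⟧ + offsetCoeff M * (⟦ length xs ⟧ - ⟦ sum (map deg xs) ⟧)
sum-weight M [] = ring (capCoeff M) (offsetCoeff M)
  where
  ring : ∀ a o → 0ℚ ≡ a * 0ℚ + o * (0ℚ - 0ℚ)
  ring = solve-∀ ℚ-ring
sum-weight M (x ∷ xs) = begin
  weight M (cap x) (deg x) + sumℚ (map (λ ch → weight M (cap ch) (deg ch)) xs)
    ≡⟨ cong (weight M (cap x) (deg x) +_) (sum-weight M xs) ⟩
  a * ⟦ cap x ⟧ + o * (1ℚ - ⟦ deg x ⟧) + (a * ⟦ Σc ⟧ + o * (⟦ length xs ⟧ - ⟦ Σd ⟧))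
    ≡⟨ ring a o ⟦ cap x ⟧ ⟦ deg x ⟧ ⟦ Σc ⟧ ⟦ length xs ⟧ ⟦ Σd ⟧ ⟩
  a * (⟦ cap x ⟧ + ⟦ Σc ⟧) + o * ((1ℚ + ⟦ length xs ⟧) - (⟦ deg x ⟧ + ⟦ Σd ⟧))
    ≡⟨ sym (cong₂ (λ u v → a * u + o * v) (⟦⟧-+ (cap x) Σc)
                  (cong₂ _-_ (⟦⟧-+ 1 (length xs)) (⟦⟧-+ (deg x) Σd))) ⟩
  a * ⟦ cap x ℕ.+ Σc ⟧ + o * (⟦ suc (length xs) ⟧ - ⟦ deg x ℕ.+ Σd ⟧) ∎
  where
  open ≡-Reasoning
  a = capCoeff M
  o = offsetCoeff M
  Σc = sum (map cap xs)
  Σd = sum (map deg xs)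
  ring : ∀ a o c d C L D →
    a * c + o * (1ℚ - d) + (a * C + o * (L - D)) ≡ a * (c + C) + o * ((1ℚ + L) - (d + D))
  ring = solve-∀ ℚ-ring

sum-prob≡sum-weight : ∀ M n (xs : List (Choice A)) →
  sumℚ (map (λ ch → prob M n (cap ch) (deg ch)) xs)
    ≡ sumℚ (map (λ ch → weight M (cap ch) (deg ch)) xs) * (1ℚ ⊘ denominator M n)
sum-prob≡sum-weight M n xs =
  trans (cong sumℚ (List.map-cong (λ ch → prob≡weight M n (cap ch) (deg ch)) xs))
        (sumℚ-*ʳ (1ℚ ⊘ denominator M n) (λ ch → weight M (cap ch) (deg ch)) xs)

newCapProb : ℕ → Model → ℕ → ℕ → BTree → ℚ
newCapProb b M n m t =
  sumℚ (map (λ ch → prob M n (cap ch) (deg ch)) (filter (λ ch → newCap ch ℕ.≟ m) (choices b (suc n) t)))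

sum-prob-choices : ∀ b l M n t → size t ≡ n → denominator M n ≢ 0ℚ →
  sumℚ (map (λ ch → prob M n (cap ch) (deg ch)) (choices b l t)) ≡ 1ℚ
sum-prob-choices b l M n t size≡n D≢0 = begin
  sumℚ (map (λ ch → prob M n (cap ch) (deg ch)) chs)
    ≡⟨ sum-prob≡sum-weight M n chs ⟩
  sumℚ (map (λ ch → weight M (cap ch) (deg ch)) chs) * I
    ≡⟨ cong (_* I) (sum-weight M chs) ⟩
  (capCoeff M * ⟦ sum (map cap chs) ⟧ + offsetCoeff M * (⟦ length chs ⟧ - ⟦ S ⟧)) * I
    ≡⟨ cong₂ (λ u v → (capCoeff M * ⟦ u ⟧ + offsetCoeff M * (v - ⟦ S ⟧)) * I)
             (trans (cong sum (map-cap-choices b l t)) size≡n)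
             (trans (cong ⟦_⟧ length-chs) (⟦nodes⟧ b l t)) ⟩
  (capCoeff M * ⟦ n ⟧ + offsetCoeff M * ((1ℚ + ⟦ S ⟧) - ⟦ S ⟧)) * I
    ≡⟨ cong (_* I) (trans (ring (capCoeff M) (offsetCoeff M) ⟦ n ⟧ ⟦ S ⟧) (sym (denominator≡ M n))) ⟩
  denominator M n * I
    ≡⟨ *-1⊘-inverseʳ (denominator M n) D≢0 ⟩
  1ℚ ∎
  where
  open ≡-Reasoning
  chs = choices b l t
  S = sum (map deg chs)
  I = 1ℚ ⊘ denominator M n
  length-chs : length chs ≡ length (caps t)
  length-chs = trans (sym (List.length-map cap chs)) (cong length (map-cap-choices b l t))
  ring : ∀ a o x s → a * x + o * ((1ℚ + s) - s) ≡ a * x + o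
  ring = solve-∀ ℚ-ring

newCapProb-mid : ∀ {b m} M n t → WellFormed b t → 2 ≤ m → m ≤ b →
  newCapProb b M n m t ≡ ⟦ countCap (m ∸ 1) t ⟧ * prob M n (m ∸ 1) 0
newCapProb-mid {b} {m} M n t wf 2≤m m≤b =
  trans (sum-newCap-mid (prob M n) (choices b (suc n) t) (choices-valid b (suc n) t wf) 2≤m m≤b)
        (cong (_* prob M n (m ∸ 1) 0) (sym (⟦countCap⟧ b (suc n) t (m ∸ 1))))

newCapProb-one : ∀ {b} M n t → WellFormed b t →
  newCapProb b M n 1 t
    ≡ (⟦ countCap b t ⟧ * weight M b 0 + offsetCoeff M * (1ℚ - ⟦ length (caps t) ⟧)) * (1ℚ ⊘ denominator M n)
newCapProb-one {b} M n t wf = begin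
  newCapProb b M n 1 t
    ≡⟨ sum-prob≡sum-weight M n (filter (λ ch → newCap ch ℕ.≟ 1) chs) ⟩
  sumℚ (map (λ ch → weight M (cap ch) (deg ch)) (filter (λ ch → newCap ch ℕ.≟ 1) chs)) * I
    ≡⟨ cong (_* I) (sum-newCap-one M chs (choices-valid b (suc n) t wf)) ⟩
  (sumℚ (map (λ ch → 𝟙[ cap ch ℕ.≟ b ]) chs) * weight M b 0 - offsetCoeff M * ⟦ S ⟧) * I
    ≡⟨ cong (λ u → (u * weight M b 0 - offsetCoeff M * ⟦ S ⟧) * I) (sym (⟦countCap⟧ b (suc n) t b)) ⟩
  (⟦ countCap b t ⟧ * weight M b 0 - offsetCoeff M * ⟦ S ⟧) * I
    ≡⟨ cong (_* I) (ring (⟦ countCap b t ⟧ * weight M b 0) (offsetCoeff M) ⟦ S ⟧) ⟩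
  (⟦ countCap b t ⟧ * weight M b 0 + offsetCoeff M * (1ℚ - (1ℚ + ⟦ S ⟧))) * I
    ≡⟨ cong (λ u → (⟦ countCap b t ⟧ * weight M b 0 + offsetCoeff M * (1ℚ - u)) * I)
            (sym (⟦nodes⟧ b (suc n) t)) ⟩
  (⟦ countCap b t ⟧ * weight M b 0 + offsetCoeff M * (1ℚ - ⟦ length (caps t) ⟧)) * I ∎
  where
  open ≡-Reasoning
  chs = choices b (suc n) t
  S = sum (map deg chs)
  I = 1ℚ ⊘ denominator M n
  ring : ∀ x o s → x - o * s ≡ x + o * (1ℚ - (1ℚ + s))
  ring = solve-∀ ℚ-ring

expect : List (ℚ × BTree) → (BTree → ℚ) → ℚ
expect d f = sumℚ (map (λ wt → proj₁ wt * f (proj₂ wt)) d)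

expect-cong : ∀ {P : BTree → Set} {f g : BTree → ℚ} d → All (P ∘ proj₂) d →
  (∀ {t} → P t → f t ≡ g t) → expect d f ≡ expect d g
expect-cong d ps f≡g = cong sumℚ (List.map-cong-local (All.map (λ {wt} p → cong (proj₁ wt *_) (f≡g p)) ps))

expect-*ʳ : ∀ d (f : BTree → ℚ) c → expect d (λ t → f t * c) ≡ expect d f * c
expect-*ʳ d f c =
  trans (cong sumℚ (List.map-cong (λ wt → sym (ℚₚ.*-assoc (proj₁ wt) (f (proj₂ wt)) c)) d))
        (sumℚ-*ʳ c (λ wt → proj₁ wt * f (proj₂ wt)) d)

expect-affine : ∀ d (f g h : BTree → ℚ) a c →
  expect d (λ t → f t * a + c * (g t - h t)) ≡ expect d f * a + c * (expect d g - expect d h)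
expect-affine []       f g h a c = ring a c
  where
  ring : ∀ a c → 0ℚ ≡ 0ℚ * a + c * (0ℚ - 0ℚ)
  ring = solve-∀ ℚ-ring
expect-affine (wt ∷ d) f g h a c =
  trans (cong (proj₁ wt * (f t * a + c * (g t - h t)) +_) (expect-affine d f g h a c))
        (ring (proj₁ wt) (f t) (g t) (h t) a c (expect d f) (expect d g) (expect d h))
  where
  t = proj₂ wt
  ring : ∀ w x y z a c X Y Z →
    w * (x * a + c * (y - z)) + (X * a + c * (Y - Z)) ≡ (w * x + X) * a + c * ((w * y + Y) - (w * z + Z))
  ring = solve-∀ ℚ-ring

expect-sum : ∀ d (f : ℕ → BTree → ℚ) js →
  sumℚ (map (λ j → expect d (f j)) js) ≡ expect d (λ t → sumℚ (map (λ j → f j t) js))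
expect-sum d f js =
  trans (sumℚ-swap (λ j wt → proj₁ wt * f j (proj₂ wt)) js d)
        (cong sumℚ (List.map-cong (λ wt → sumℚ-*ˡ (proj₁ wt) (λ j → f j (proj₂ wt)) js) d))

PK≡expect : ∀ b M n m → PK b M n m ≡ expect (treeDist b M n) (newCapProb b M n m)
PK≡expect b M n m =
  trans (sumℚ-concatMap _ (treeDist b M n))
        (cong sumℚ (List.map-cong (λ wt → sumℚ-*ˡ (proj₁ wt) _ (filter _ (choices b (suc n) (proj₂ wt))))
                                  (treeDist b M n)))

expect-treeDist′-suc : ∀ b M k (f : BTree → ℚ) →
  expect (treeDist′ b M (suc k)) f
    ≡ expect (treeDist′ b M k)
        (λ t → sumℚ (map (λ ch → prob M (suc k) (cap ch) (deg ch) * f (result ch)) (choices b (suc (suc k)) t)))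
expect-treeDist′-suc b M k f = begin
  sumℚ (map h (concatMap G d))                 ≡⟨ cong sumℚ (List.map-concatMap h G d) ⟩
  sumℚ (concatMap (map h ∘ G) d)               ≡⟨ sumℚ-concatMap (map h ∘ G) d ⟩
  sumℚ (map (λ wt → sumℚ (map h (G wt))) d)    ≡⟨ cong sumℚ (List.map-cong step d) ⟩
  expect d (λ t → sumℚ (map (λ ch → p ch * f (result ch)) (choices b (suc (suc k)) t))) ∎
  where
  open ≡-Reasoning
  d = treeDist′ b M k
  p : Choice BTree → ℚ
  p ch = prob M (suc k) (cap ch) (deg ch)
  h : ℚ × BTree → ℚ
  h wt = proj₁ wt * f (proj₂ wt)
  G : ℚ × BTree → List (ℚ × BTree)
  G wt = map (λ ch → (proj₁ wt * p ch , result ch)) (choices b (suc (suc k)) (proj₂ wt))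
  step : ∀ wt →
    sumℚ (map h (G wt)) ≡ proj₁ wt * sumℚ (map (λ ch → p ch * f (result ch)) (choices b (suc (suc k)) (proj₂ wt)))
  step (w , t) =
    trans (cong sumℚ (sym (List.map-∘ (choices b (suc (suc k)) t))))
      (trans (cong sumℚ (List.map-cong (λ ch → ℚₚ.*-assoc w (p ch) (f (result ch))) (choices b (suc (suc k)) t)))
             (sumℚ-*ˡ w (λ ch → p ch * f (result ch)) (choices b (suc (suc k)) t)))

Reachable : ℕ → ℕ → BTree → Set
Reachable b n t = WellFormed b t × size t ≡ n

treeDist′-reachable : ∀ b M → 1 ≤ b → ∀ k → All (Reachable b (suc k) ∘ proj₂) (treeDist′ b M k)
treeDist′-reachable b M 1≤b ℕ.zero = ((s≤s z≤n , 1≤b , (λ _ → refl) , tt) , refl) ∷ []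
treeDist′-reachable b M 1≤b (suc k) =
  All.concat⁺ (All.map⁺ (All.map (λ {wt} → next wt) (treeDist′-reachable b M 1≤b k)))
  where
  next : ∀ wt → Reachable b (suc k) (proj₂ wt) →
    All (Reachable b (suc (suc k)) ∘ proj₂)
        (map (λ ch → (proj₁ wt * prob M (suc k) (cap ch) (deg ch) , result ch)) (choices b (suc (suc k)) (proj₂ wt)))
  next (w , t) (wf , size≡) =
    All.map⁺ (All.map (λ (wf′ , grows) → wf′ , trans grows (cong suc size≡))
                      (choices-grow b (suc (suc k)) t 1≤b wf))

treeDist′-mass : ∀ b M → 1 ≤ b → ValidModel M → ∀ k → expect (treeDist′ b M k) (λ _ → 1ℚ) ≡ 1ℚ
treeDist′-mass b M 1≤b valid ℕ.zero    = refl
treeDist′-mass b M 1≤b valid (suc k) = begin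
  expect (treeDist′ b M (suc k)) (λ _ → 1ℚ)
    ≡⟨ expect-treeDist′-suc b M k (λ _ → 1ℚ) ⟩
  expect (treeDist′ b M k)
         (λ t → sumℚ (map (λ ch → prob M (suc k) (cap ch) (deg ch) * 1ℚ) (choices b (suc (suc k)) t)))
    ≡⟨ expect-cong (treeDist′ b M k) (treeDist′-reachable b M 1≤b k) total ⟩
  expect (treeDist′ b M k) (λ _ → 1ℚ)
    ≡⟨ treeDist′-mass b M 1≤b valid k ⟩
  1ℚ ∎
  where
  open ≡-Reasoning
  total : ∀ {t} → Reachable b (suc k) t →
    sumℚ (map (λ ch → prob M (suc k) (cap ch) (deg ch) * 1ℚ) (choices b (suc (suc k)) t)) ≡ 1ℚ
  total {t} (_ , size≡) =
    trans (cong sumℚ (List.map-cong (λ ch → ℚₚ.*-identityʳ (prob M (suc k) (cap ch) (deg ch)))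
                                    (choices b (suc (suc k)) t)))
          (sum-prob-choices b (suc (suc k)) M (suc k) t size≡ (denominator≢0 M valid k))

sumEN≡expect-nodes : ∀ b M → 1 ≤ b → ∀ k →
  sumEN b M (suc k) ≡ expect (treeDist′ b M k) (λ t → ⟦ length (caps t) ⟧)
sumEN≡expect-nodes b M 1≤b k =
  trans (expect-sum (treeDist′ b M k) (λ j t → ⟦ countCap (suc j) t ⟧) (upTo b))
        (expect-cong (treeDist′ b M k) (treeDist′-reachable b M 1≤b k)
                     (λ {t} (wf , _) → sum-count-upTo b (caps t) (caps-range t wf)))

PK-mid : ∀ b M → 1 ≤ b → ∀ k m → 2 ≤ m → m ≤ b →
  PK b M (suc k) m ≡ EN b M (suc k) (m ∸ 1) * factorMid M (suc k) m
PK-mid b M 1≤b k m 2≤m m≤b = begin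
  PK b M n m
    ≡⟨ PK≡expect b M n m ⟩
  expect d (newCapProb b M n m)
    ≡⟨ expect-cong d (treeDist′-reachable b M 1≤b k) (λ {t} (wf , _) → newCapProb-mid M n t wf 2≤m m≤b) ⟩
  expect d (λ t → ⟦ countCap (m ∸ 1) t ⟧ * prob M n (m ∸ 1) 0)
    ≡⟨ expect-*ʳ d (λ t → ⟦ countCap (m ∸ 1) t ⟧) (prob M n (m ∸ 1) 0) ⟩
  EN b M n (m ∸ 1) * prob M n (m ∸ 1) 0
    ≡⟨ cong (EN b M n (m ∸ 1) *_) (sym (factorMid≡prob M n m)) ⟩
  EN b M n (m ∸ 1) * factorMid M n m ∎
  where
  open ≡-Reasoning
  n = suc k
  d = treeDist′ b M k

PK-one : ∀ b M → 1 ≤ b → ValidModel M → ∀ k → PK b M (suc k) 1 ≡ rhsOne b M (suc k)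
PK-one b M 1≤b valid k = begin
  PK b M n 1
    ≡⟨ PK≡expect b M n 1 ⟩
  expect d (newCapProb b M n 1)
    ≡⟨ expect-cong d (treeDist′-reachable b M 1≤b k) (λ {t} (wf , _) → newCapProb-one M n t wf) ⟩
  expect d (λ t → (⟦ countCap b t ⟧ * w + offsetCoeff M * (1ℚ - nodes t)) * I)
    ≡⟨ expect-*ʳ d _ I ⟩
  expect d (λ t → ⟦ countCap b t ⟧ * w + offsetCoeff M * (1ℚ - nodes t)) * I
    ≡⟨ cong (_* I) (expect-affine d (λ t → ⟦ countCap b t ⟧) (λ _ → 1ℚ) nodes w (offsetCoeff M)) ⟩
  (EN b M n b * w + offsetCoeff M * (expect d (λ _ → 1ℚ) - expect d nodes)) * I
    ≡⟨ cong₂ (λ u v → (EN b M n b * w + offsetCoeff M * (u - v)) * I)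
             (treeDist′-mass b M 1≤b valid k) (sym (sumEN≡expect-nodes b M 1≤b k)) ⟩
  (EN b M n b * w + offsetCoeff M * (1ℚ - sumEN b M n)) * I
    ≡⟨ sym (rhsOne≡ b M n) ⟩
  rhsOne b M n ∎
  where
  open ≡-Reasoning
  n = suc k
  d = treeDist′ b M k
  w = weight M b 0
  I = 1ℚ ⊘ denominator M n
  nodes : BTree → ℚ
  nodes t = ⟦ length (caps t) ⟧

mainTheorem4 : (b : ℕ) → 1 ≤ b → (M : Model) → ValidModel M → (n : ℕ) → 1 ≤ n →
    ((m : ℕ) → 2 ≤ m → m ≤ b → PK b M n m ≡ EN b M n (m ∸ 1) * factorMid M n m)
    × (PK b M n 1 ≡ rhsOne b M n)
mainTheorem4 b 1≤b M valid (suc k) _ = (λ m → PK-mid b M 1≤b k m) , PK-one b M 1≤b valid k
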